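{- Let $p$ be an odd prime, let $Q_0$ be an integer with $p\mid Q_0$, let $L$ and $v$ be positive integers and let $\boldsymbol{h}=(h_1,\dots,h_L)\in\mathbb{Z}^L$. For $I\subseteq\{1,\dots,L\}$ put $H_I=\sum_{i\in I}h_i$, let $T$ be the set of residues modulo $p^v$ of the numbers $H_I$, and for $\tau\in T$ let $\mu(\tau)=\#\{I\subseteq\{1,\dots,L\}: H_I\equiv\tau\ (\mathrm{mod}\ p^v)\}$. If $\mu(\tau)$ is even for every $\tau\in T$, then there exists some $1\le i\le L$ with $p\mid h_i$. -}

module Defs where

open import Data.Nat as ℕ using (ℕ; zero; suc; _^_)
open import Data.Nat.Divisibility as ℕD using ()
open import Data.Integer as ℤ using (ℤ; _-_; ∣_∣)
open import Data.Fin using (Fin; zero; suc)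
open import Data.Fin.Subset using (Subset; inside; outside; _∈_)
open import Data.Vec using (Vec; []; _∷_)
open import Data.List as List using (List; []; _∷_; map; _++_; length; filter)
open import Relation.Nullary using (Dec)

allSubsets : ∀ L → List (Subset L)
allSubsets zero = [] ∷ []
allSubsets (suc L) =
  map (outside ∷_) (allSubsets L) ++ map (inside ∷_) (allSubsets L)

H : ∀ {L} → (Fin L → ℤ) → Subset L → ℤ
H {zero} h [] = ℤ.0ℤ
H {suc L} h (outside ∷ I) = H (λ i → h (suc i)) I
H {suc L} h (inside ∷ I) = h zero ℤ.+ H (λ i → h (suc i)) I

_≡_[mod_] : ℤ → ℤ → ℕ → Set
a ≡ b [mod m ] = m ℕD.∣ ∣ a - b ∣

_≡?_[mod_] : ∀ a b m → Dec (a ≡ b [mod m ])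
a ≡? b [mod m ] = m ℕD.∣? ∣ a - b ∣

μ : ∀ {L} → (p v : ℕ) → (Fin L → ℤ) → ℤ → ℕ
μ {L} p v h τ = length (filter (λ I → H h I ≡? τ [mod p ^ v ]) (allSubsets L))

module Submission where

-- Let N = p ^ v and let f_h(τ) be the parity of μ(τ). Splitting the subsets I
-- according to whether they contain the first index gives
-- f_h(τ) = f_h'(τ) + f_h'(τ - h₁), i.e. f_h = Δ h₁ f_h' with h' the remaining
-- tuple. Every f_h is N-periodic, and for the empty tuple f is the indicator of
-- Nℤ, which is non-constant as N > 1. Non-constancy survives each step when
-- gcd(h₁, N) = 1 and N is odd: Δ h₁ f ≡ 0 makes f h₁-periodic, hence 1-periodic
-- by Bézout; Δ h₁ f ≡ 1 gives f(τ - N h₁) = f(τ) + N = f(τ) + 1, contradicting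
-- N-periodicity. So if p divides no h_i then f_h is non-constant, whereas the
-- hypothesis makes every μ(τ) even (μ vanishes off T and is constant on residue
-- classes).

open import Defs
open import Data.Nat using (ℕ; _^_; _>_)
open import Data.Nat.Divisibility using (_∣_)
open import Data.Nat.Primality using (Prime)
open import Data.Integer as ℤ using (ℤ)
open import Data.Integer.Divisibility as ℤD using ()
open import Data.Fin using (Fin)
open import Data.Fin.Subset using (Subset)
open import Data.Product using (∃)
open import Relation.Nullary using (¬_)

import Data.Nat as ℕ
open import Data.Nat using (zero; suc; parity)
open import Data.Nat.Divisibility using (divides; _∣?_; ∣-refl; ∣-trans; ∣1⇒≡1; _∣0; m∣m*n)
open import Data.Nat.Coprimality using (Coprime; coprime-Bézout; coprime-divisor)
open import Data.Nat.GCD using (module Bézout)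
open import Data.Nat.Primality using (prime⇒irreducible; prime⇒nonTrivial)
open import Data.Integer using (+_; -[1+_]; _+_; _-_; -_; _*_; ∣_∣; 0ℤ; 1ℤ)
open import Data.Integer.Properties using (+-assoc; neg-involutive; neg-distribˡ-*; pos-*)
open import Data.Integer.Divisibility.Signed as ℤS using (∣ᵤ⇒∣; ∣⇒∣ᵤ; ∣m∣n⇒∣m+n; ∣m⇒∣-m)
open import Data.Integer.Tactic.RingSolver using (solve-∀)
open import Data.Parity as ℙ using (Parity; 0ℙ; 1ℙ; _⁻¹)
open import Data.Parity.Properties as ℙₚ
  using (+-cancelˡ-≡; p+p≡0ℙ; p+p⁻¹≡1ℙ; p≢p⁻¹; ⁻¹-selfInverse; *-zeroʳ; suc-homo-⁻¹; +-homo-+; *-homo-*)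
open import Data.Fin using (zero; suc)
open import Data.Fin.Properties using (any?)
open import Data.Fin.Subset using (inside; outside)
open import Data.Vec using (_∷_)
open import Data.List using ([]; _∷_; _++_; map; filter; length)
open import Data.List.Properties using (filter-++; length-++; length-map; filter-≐; filter-accept; filter-reject; filter-none)
open import Data.Bool using (true; false)
import Data.List.Relation.Unary.Any as Any
open import Data.List.Relation.Unary.All.Properties using (¬Any⇒All¬)
open import Data.Product using (_,_)
open import Data.Sum using (inj₁; inj₂)
open import Data.Empty using (⊥-elim)
open import Function using (_∘_)
open import Relation.Nullary using (yes; no; does; contradiction)
open import Relation.Unary using (Pred; Decidable)
open import Level using (0ℓ)
open import Relation.Binary.PropositionalEquality
open ≡-Reasoning

even⇒parity≡0ℙ : ∀ {n} → 2 ∣ n → parity n ≡ 0ℙ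
even⇒parity≡0ℙ (divides q refl) = trans (*-homo-* q 2) (*-zeroʳ (parity q))

parity≡0ℙ⇒even : ∀ n → parity n ≡ 0ℙ → 2 ∣ n
parity≡0ℙ⇒even zero          _ = divides 0 refl
parity≡0ℙ⇒even (suc (suc n)) e with divides q eq ← parity≡0ℙ⇒even n e =
  divides (suc q) (cong (2 ℕ.+_) eq)

odd⇒parity≡1ℙ : ∀ {n} → ¬ 2 ∣ n → parity n ≡ 1ℙ
odd⇒parity≡1ℙ {n} n-odd with parity n in eq
... | 0ℙ = contradiction (parity≡0ℙ⇒even n eq) n-odd
... | 1ℙ = refl

parity-^ : ∀ {m} → parity m ≡ 1ℙ → ∀ k → parity (m ^ k) ≡ 1ℙ
parity-^ m-odd zero    = refl
parity-^ {m} m-odd (suc k) = begin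
  parity (m ℕ.* m ^ k)          ≡⟨ *-homo-* m (m ^ k) ⟩
  parity m ℙ.* parity (m ^ k)   ≡⟨ cong₂ ℙ._*_ m-odd (parity-^ m-odd k) ⟩
  1ℙ                            ∎

+≡0ℙ⇒≡ : ∀ {p q} → p ℙ.+ q ≡ 0ℙ → q ≡ p
+≡0ℙ⇒≡ {p} {q} e = +-cancelˡ-≡ p q p (trans e (sym (p+p≡0ℙ p)))

+≡1ℙ⇒≡⁻¹ : ∀ {p q} → p ℙ.+ q ≡ 1ℙ → q ≡ p ⁻¹
+≡1ℙ⇒≡⁻¹ {p} {q} e = +-cancelˡ-≡ p q (p ⁻¹) (trans e (sym (p+p⁻¹≡1ℙ p)))

Periodic : {A : Set} → (ℤ → A) → ℤ → Set
Periodic f δ = ∀ τ → f (τ + δ) ≡ f τ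

NonConstant : {A : Set} → (ℤ → A) → Set
NonConstant f = ∀ c → ¬ (∀ τ → f τ ≡ c)

≢⇒nonConstant : ∀ {A : Set} {f : ℤ → A} {a b} → f a ≢ f b → NonConstant f
≢⇒nonConstant fa≢fb c f≡c = fa≢fb (trans (f≡c _) (sym (f≡c _)))

nonConstant-≗ : ∀ {A : Set} {f g : ℤ → A} → f ≗ g → NonConstant g → NonConstant f
nonConstant-≗ f≗g g-nc c f≡c = g-nc c (λ τ → trans (sym (f≗g τ)) (f≡c τ))

module _ {A : Set} {f : ℤ → A} where

  periodic-neg : ∀ {δ} → Periodic f δ → Periodic f (- δ)
  periodic-neg {δ} per τ = trans (sym (per (τ - δ))) (cong f (i-j+j≡i τ δ))
    where
    i-j+j≡i : ∀ i j → (i - j) + j ≡ i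
    i-j+j≡i = solve-∀

  periodic-+ : ∀ {δ ε} → Periodic f δ → Periodic f ε → Periodic f (δ + ε)
  periodic-+ {δ} {ε} pδ pε τ = trans (cong f (sym (+-assoc τ δ ε))) (trans (pε (τ + δ)) (pδ τ))

  periodic-*ℕ : ∀ {δ} → Periodic f δ → ∀ k → Periodic f (+ k * δ)
  periodic-*ℕ per zero    τ = cong f (i+0≡i τ)
    where
    i+0≡i : ∀ i → i + 0ℤ ≡ i
    i+0≡i = solve-∀
  periodic-*ℕ {δ} per (suc k) =
    subst (Periodic f) (sym ([1+k]*δ≡δ+k*δ (+ k) δ)) (periodic-+ per (periodic-*ℕ per k))
    where
    [1+k]*δ≡δ+k*δ : ∀ k δ → (1ℤ + k) * δ ≡ δ + k * δ
    [1+k]*δ≡δ+k*δ = solve-∀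

  periodic-* : ∀ {δ} → Periodic f δ → ∀ i → Periodic f (i * δ)
  periodic-* per (+ k)    = periodic-*ℕ per k
  periodic-* {δ} per -[1+ k ] =
    subst (Periodic f) (neg-distribˡ-* (+ suc k) δ) (periodic-neg (periodic-*ℕ per (suc k)))

  periodic-∣∣ : ∀ {δ} → Periodic f δ → Periodic f (+ ∣ δ ∣)
  periodic-∣∣ {+ n}      per = per
  periodic-∣∣ { -[1+ n ]} per = periodic-neg per

  bézout⇒periodic-1 : ∀ {m n} x y → 1 ℕ.+ y ℕ.* n ≡ x ℕ.* m →
                      Periodic f (+ m) → Periodic f (+ n) → Periodic f 1ℤ
  bézout⇒periodic-1 {m} {n} x y eq pm pn =
    subst (Periodic f) xm-yn≡1 (periodic-+ (periodic-* pm (+ x)) (periodic-neg (periodic-* pn (+ y))))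
    where
    i+j-j≡i : ∀ i j → (i + j) - j ≡ i
    i+j-j≡i = solve-∀
    xm-yn≡1 : + x * + m - + y * + n ≡ 1ℤ
    xm-yn≡1 = begin
      + x * + m - + y * + n            ≡⟨ cong₂ _-_ (sym (pos-* x m)) (sym (pos-* y n)) ⟩
      + (x ℕ.* m) - + (y ℕ.* n)        ≡⟨ cong (λ z → + z - + (y ℕ.* n)) (sym eq) ⟩
      1ℤ + + (y ℕ.* n) - + (y ℕ.* n)   ≡⟨ i+j-j≡i 1ℤ (+ (y ℕ.* n)) ⟩
      1ℤ                               ∎

  periodic-coprime⇒periodic-1 : ∀ {δ ε} → Coprime ∣ δ ∣ ∣ ε ∣ →
                                Periodic f δ → Periodic f ε → Periodic f 1ℤ
  periodic-coprime⇒periodic-1 cop pδ pε with coprime-Bézout cop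
  ... | Bézout.+- x y eq = bézout⇒periodic-1 x y eq (periodic-∣∣ pδ) (periodic-∣∣ pε)
  ... | Bézout.-+ x y eq = bézout⇒periodic-1 y x eq (periodic-∣∣ pε) (periodic-∣∣ pδ)

  periodic-1⇒constant : Periodic f 1ℤ → ∀ τ → f τ ≡ f 0ℤ
  periodic-1⇒constant per τ = trans (cong f (sym (0+i*1≡i τ))) (periodic-* per τ 0ℤ)
    where
    0+i*1≡i : ∀ i → 0ℤ + i * 1ℤ ≡ i
    0+i*1≡i = solve-∀

Antiperiodic : (ℤ → Parity) → ℤ → Set
Antiperiodic f δ = ∀ τ → f (τ + δ) ≡ f τ ⁻¹

antiperiodic-*ℕ : ∀ {f δ} → Antiperiodic f δ → ∀ k τ → f (τ + δ * + k) ≡ parity k ℙ.+ f τ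
antiperiodic-*ℕ {f} {δ} anti zero τ = cong f (i+j*0≡i τ δ)
  where
  i+j*0≡i : ∀ i j → i + j * 0ℤ ≡ i
  i+j*0≡i = solve-∀
antiperiodic-*ℕ {f} {δ} anti (suc k) τ = begin
  f (τ + δ * + suc k)       ≡⟨ cong f (shift τ δ (+ k)) ⟩
  f ((τ + δ * + k) + δ)     ≡⟨ anti (τ + δ * + k) ⟩
  f (τ + δ * + k) ⁻¹        ≡⟨ cong _⁻¹ (antiperiodic-*ℕ anti k τ) ⟩
  (parity k ℙ.+ f τ) ⁻¹     ≡⟨ sym (ℙₚ.+-assoc 1ℙ (parity k) (f τ)) ⟩
  parity k ⁻¹ ℙ.+ f τ       ≡⟨ cong (ℙ._+ f τ) (⁻¹-selfInverse (suc-homo-⁻¹ k)) ⟩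
  parity (suc k) ℙ.+ f τ    ∎
  where
  shift : ∀ i j k → i + j * (1ℤ + k) ≡ (i + j * k) + j
  shift = solve-∀

Δ : ℤ → (ℤ → Parity) → ℤ → Parity
Δ h f τ = f τ ℙ.+ f (τ - h)

Δ-nonConstant : ∀ {N h f} → parity N ≡ 1ℙ → Coprime ∣ h ∣ N →
                Periodic f (+ N) → NonConstant f → NonConstant (Δ h f)
Δ-nonConstant {N} {h} {f} _ cop pN nc 0ℙ Δ≡0 =
  nc (f 0ℤ) (periodic-1⇒constant (periodic-coprime⇒periodic-1 cop ph pN))
  where
  ph : Periodic f h
  ph = subst (Periodic f) (neg-involutive h) (periodic-neg (λ τ → +≡0ℙ⇒≡ (Δ≡0 τ)))
Δ-nonConstant {N} {h} {f} N-odd _ pN _ 1ℙ Δ≡1 = p≢p⁻¹ (f 0ℤ) (begin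
  f 0ℤ                   ≡⟨ sym (periodic-* pN (- h) 0ℤ) ⟩
  f (0ℤ + - h * + N)     ≡⟨ antiperiodic-*ℕ {f} { - h} (λ τ → +≡1ℙ⇒≡⁻¹ (Δ≡1 τ)) N 0ℤ ⟩
  parity N ℙ.+ f 0ℤ      ≡⟨ cong (ℙ._+ f 0ℤ) N-odd ⟩
  f 0ℤ ⁻¹                ∎)

prime∤⇒coprime : ∀ {p n} → Prime p → ¬ p ∣ n → Coprime n p
prime∤⇒coprime p-prime p∤n (d∣n , d∣p) with prime⇒irreducible p-prime d∣p
... | inj₁ d≡1 = d≡1
... | inj₂ d≡p = contradiction (subst (_∣ _) d≡p d∣n) p∤n

coprime-* : ∀ {n a b} → Coprime n a → Coprime n b → Coprime n (a ℕ.* b)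
coprime-* na nb (d∣n , d∣ab) =
  nb (d∣n , coprime-divisor (λ (e∣d , e∣a) → na (∣-trans e∣d d∣n , e∣a)) d∣ab)

coprime-^ : ∀ {n a} → Coprime n a → ∀ k → Coprime n (a ^ k)
coprime-^ na zero    (_ , d∣1) = ∣1⇒≡1 d∣1
coprime-^ na (suc k) = coprime-* na (coprime-^ na k)

prime^v∤1 : ∀ {p v} → Prime p → v > 0 → ¬ p ^ v ∣ 1
prime^v∤1 {p} {suc v} p-prime _ p^v∣1 =
  ℕ.nonTrivial⇒≢1 {{prime⇒nonTrivial p-prime}} (∣1⇒≡1 (∣-trans (m∣m*n (p ^ v)) p^v∣1))

≡-mod-trans : ∀ {a b c m} → a ≡ b [mod m ] → b ≡ c [mod m ] → a ≡ c [mod m ]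
≡-mod-trans {a} {b} {c} {m} a≡b b≡c =
  ∣⇒∣ᵤ (subst (+ m ℤS.∣_) (telescope a b c)
             (∣m∣n⇒∣m+n (∣ᵤ⇒∣ {+ m} {a - b} a≡b) (∣ᵤ⇒∣ {+ m} {b - c} b≡c)))
  where
  telescope : ∀ a b c → (a - b) + (b - c) ≡ a - c
  telescope = solve-∀

≡-mod-sym : ∀ {a b m} → a ≡ b [mod m ] → b ≡ a [mod m ]
≡-mod-sym {a} {b} {m} a≡b = ∣⇒∣ᵤ (subst (+ m ℤS.∣_) (neg-diff a b) (∣m⇒∣-m (∣ᵤ⇒∣ {+ m} {a - b} a≡b)))
  where
  neg-diff : ∀ a b → - (a - b) ≡ b - a
  neg-diff = solve-∀

filter-map : ∀ {A B : Set} {P : Pred B 0ℓ} (P? : Decidable P) (f : A → B) xs →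
             filter P? (map f xs) ≡ map f (filter (P? ∘ f) xs)
filter-map P? f []       = refl
filter-map P? f (x ∷ xs) with does (P? (f x))
... | true  = cong (f x ∷_) (filter-map P? f xs)
... | false = filter-map P? f xs

length-filter-map : ∀ {A B : Set} {P : Pred B 0ℓ} (P? : Decidable P) (f : A → B) xs →
                    length (filter P? (map f xs)) ≡ length (filter (P? ∘ f) xs)
length-filter-map P? f xs =
  trans (cong length (filter-map P? f xs)) (length-map f (filter (P? ∘ f) xs))

module _ (p v : ℕ) where

  μ-cong : ∀ {L} (h : Fin L → ℤ) {a b} → a ≡ b [mod p ^ v ] → μ p v h a ≡ μ p v h b
  μ-cong {L} h {a} {b} a≡b =
    cong length (filter-≐ _ _ (to , from) (allSubsets L))
    where
    to : ∀ {I} → H h I ≡ a [mod p ^ v ] → H h I ≡ b [mod p ^ v ]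
    to {I} x = ≡-mod-trans {H h I} x a≡b
    from : ∀ {I} → H h I ≡ b [mod p ^ v ] → H h I ≡ a [mod p ^ v ]
    from {I} x = ≡-mod-trans {H h I} x (≡-mod-sym {a} a≡b)

  μ-periodic : ∀ {L} (h : Fin L → ℤ) → Periodic (μ p v h) (+ (p ^ v))
  μ-periodic h τ = μ-cong h (subst (λ z → p ^ v ∣ ∣ z ∣) (sym (i+j-i≡j τ (+ (p ^ v)))) ∣-refl)
    where
    i+j-i≡j : ∀ i j → (i + j) - i ≡ j
    i+j-i≡j = solve-∀

  μ-suc : ∀ {L} (h : Fin (suc L) → ℤ) τ →
          μ p v h τ ≡ μ p v (h ∘ suc) τ ℕ.+ μ p v (h ∘ suc) (τ - h zero)
  μ-suc {L} h τ = begin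
    length (filter D (map (outside ∷_) S ++ map (inside ∷_) S))
      ≡⟨ cong length (filter-++ D (map (outside ∷_) S) _) ⟩
    length (filter D (map (outside ∷_) S) ++ filter D (map (inside ∷_) S))
      ≡⟨ length-++ (filter D (map (outside ∷_) S)) ⟩
    length (filter D (map (outside ∷_) S)) ℕ.+ length (filter D (map (inside ∷_) S))
      ≡⟨ cong₂ ℕ._+_ (length-filter-map D (outside ∷_) S) (length-filter-map D (inside ∷_) S) ⟩
    μ p v (h ∘ suc) τ ℕ.+ length (filter (D ∘ (inside ∷_)) S)
      ≡⟨ cong (λ n → μ p v (h ∘ suc) τ ℕ.+ length n) (filter-≐ _ _ (move , move⁻¹) S) ⟩
    μ p v (h ∘ suc) τ ℕ.+ μ p v (h ∘ suc) (τ - h zero) ∎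
    where
    S = allSubsets L
    D = λ I → H h I ≡? τ [mod p ^ v ]
    diff : ∀ a x τ → (a + x) - τ ≡ x - (τ - a)
    diff = solve-∀
    move : ∀ {I} → (h zero + H (h ∘ suc) I) ≡ τ [mod p ^ v ] →
           H (h ∘ suc) I ≡ (τ - h zero) [mod p ^ v ]
    move {I} = subst (λ z → p ^ v ∣ ∣ z ∣) (diff (h zero) (H (h ∘ suc) I) τ)
    move⁻¹ : ∀ {I} → H (h ∘ suc) I ≡ (τ - h zero) [mod p ^ v ] →
             (h zero + H (h ∘ suc) I) ≡ τ [mod p ^ v ]
    move⁻¹ {I} = subst (λ z → p ^ v ∣ ∣ z ∣) (sym (diff (h zero) (H (h ∘ suc) I) τ))

  μ-[]-0 : (h : Fin 0 → ℤ) → μ p v h 0ℤ ≡ 1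
  μ-[]-0 h = cong length (filter-accept (λ I → H h I ≡? 0ℤ [mod p ^ v ]) ((p ^ v) ∣0))

  μ-[]-1 : (h : Fin 0 → ℤ) → ¬ p ^ v ∣ 1 → μ p v h 1ℤ ≡ 0
  μ-[]-1 h p^v∤1 = cong length (filter-reject (λ I → H h I ≡? 1ℤ [mod p ^ v ]) p^v∤1)

  μ-even : ∀ {L} (h : Fin L → ℤ) → (∀ I → 2 ∣ μ p v h (H h I)) → ∀ τ → 2 ∣ μ p v h τ
  μ-even {L} h even-on-T τ with Any.any? (λ I → H h I ≡? τ [mod p ^ v ]) (allSubsets L)
  ... | yes hit = let I , HI≡τ = Any.satisfied hit in subst (2 ∣_) (μ-cong h HI≡τ) (even-on-T I)
  ... | no miss = subst (2 ∣_) (sym (cong length (filter-none _ (¬Any⇒All¬ _ miss)))) (2 ∣0)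

  parity∘μ-nonConstant : ¬ p ^ v ∣ 1 → parity (p ^ v) ≡ 1ℙ →
                         ∀ {L} (h : Fin L → ℤ) → (∀ i → Coprime ∣ h i ∣ (p ^ v)) →
                         NonConstant (parity ∘ μ p v h)
  parity∘μ-nonConstant p^v∤1 _ {zero} h _ =
    ≢⇒nonConstant {a = 0ℤ} {b = 1ℤ}
      (subst₂ _≢_ (sym (cong parity (μ-[]-0 h))) (sym (cong parity (μ-[]-1 h p^v∤1))) (λ ()))
  parity∘μ-nonConstant p^v∤1 N-odd {suc L} h coprime =
    nonConstant-≗ (λ τ → trans (cong parity (μ-suc h τ)) (+-homo-+ (μ p v (h ∘ suc) τ) _))
      (Δ-nonConstant {h = h zero} N-odd (coprime zero) (λ τ → cong parity (μ-periodic (h ∘ suc) τ))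
        (parity∘μ-nonConstant p^v∤1 N-odd (h ∘ suc) (coprime ∘ suc)))

lemma5p5 : (p : ℕ) → Prime p → ¬ (2 ∣ p) → (Q₀ : ℤ) → (ℤ.+ p) ℤD.∣ Q₀ →
           (L v : ℕ) → L > 0 → v > 0 → (h : Fin L → ℤ) →
           (∀ (I : Subset L) → 2 ∣ μ p v h (H h I)) →
           ∃ λ (i : Fin L) → (ℤ.+ p) ℤD.∣ h i
lemma5p5 p p-prime p-odd _ _ L v _ v>0 h even-on-T with any? (λ i → p ∣? ∣ h i ∣)
... | yes p∣hᵢ = p∣hᵢ
... | no p∤h = ⊥-elim (parity∘μ-nonConstant p v (prime^v∤1 p-prime v>0) N-odd h coprime 0ℙ
                 (λ τ → even⇒parity≡0ℙ (μ-even p v h even-on-T τ)))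
  where
  N-odd : parity (p ^ v) ≡ 1ℙ
  N-odd = parity-^ (odd⇒parity≡1ℙ p-odd) v
  coprime : ∀ i → Coprime ∣ h i ∣ (p ^ v)
  coprime i = coprime-^ (prime∤⇒coprime p-prime (λ p∣hᵢ → p∤h (i , p∣hᵢ))) v
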